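{- Let $P$ be a finite poset and $A$ a sub-digraph of $P$. Then the lattice $\mathcal{D}(P)$ (downsets ordered by inclusion, with meet $\cap$ and join $\cup$) is compatible with the graph $G(P,A)$: if $D\sim D'$ and $E\sim E'$ in $G(P,A)$ then $D\cup E\sim D'\cup E'$ and $D\cap E\sim D'\cap E'$.
   Context: A poset $P$ is viewed as a reflexive digraph with an arc $(a,b)$ whenever $a\le b$ (including loops); a sub-digraph $A$ of $P$ has the same vertex set and a subset of the arcs. The graph $G(P,A)$ has vertex set $\mathcal{D}(P)$, the set of downsets of $P$, with $D\sim D'$ iff $A$ contains every arc $(x,y)$ of $P$ for which $x,y$ both lie in $D\setminus D'$ or both lie in $D'\setminus D$. -}

module Defs where

open import Level using (Level; _⊔_) renaming (suc to lsuc)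
open import Data.Nat using (ℕ)
open import Data.Fin using (Fin)
open import Data.Fin.Subset using (Subset; _∈_; _∉_)
open import Data.Product using (_×_)
open import Data.Sum using (_⊎_)
open import Relation.Binary.Core using (Rel)
open import Relation.Binary.Structures using (IsPartialOrder)
open import Relation.Binary.PropositionalEquality using (_≡_)

-- A finite poset: the carrier is Fin n (every finite set is in bijection
-- with some Fin n), with a partial order _≤_ (w.r.t. propositional equality).
record FinPoset ℓ : Set (lsuc ℓ) where
  field
    size      : ℕ
    _≤_       : Rel (Fin size) ℓ
    isPartialOrder : IsPartialOrder _≡_ _≤_

-- A sub-digraph of P (viewed as the reflexive digraph of all arcs (a,b)
-- with a ≤ b): same vertices, a subset of the arcs.
record SubDigraph {ℓ} (P : FinPoset ℓ) ℓ′ : Set (ℓ ⊔ lsuc ℓ′) where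
  open FinPoset P
  field
    Arc    : Rel (Fin size) ℓ′
    arc⊆≤  : ∀ {x y} → Arc x y → x ≤ y

IsDownset : ∀ {ℓ} (P : FinPoset ℓ) → Subset (FinPoset.size P) → Set ℓ
IsDownset P D = ∀ {x y} → x ≤ y → y ∈ D → x ∈ D
  where open FinPoset P

InDiff : ∀ {n} → Subset n → Subset n → Fin n → Set
InDiff D D′ x = x ∈ D × x ∉ D′

Adj : ∀ {ℓ ℓ′} (P : FinPoset ℓ) (A : SubDigraph P ℓ′) →
      Subset (FinPoset.size P) → Subset (FinPoset.size P) → Set (ℓ ⊔ ℓ′)
Adj P A D D′ =
  ∀ x y → x ≤ y →
    ((InDiff D D′ x × InDiff D D′ y) ⊎ (InDiff D′ D x × InDiff D′ D y)) →
    SubDigraph.Arc A x y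
  where open FinPoset P

-- An arc x ≤ y with both ends in (D ∪ E) ∖ (D′ ∪ E′) lies inside D ∖ D′ or
-- inside E ∖ E′: its top y lies in D (say), hence so does x as D is a downset,
-- and both avoid D′.  Dually, an arc with both ends in (D ∩ E) ∖ (D′ ∩ E′) has
-- its bottom x outside D′ (say), hence so is y as D′ is a downset.  Either way
-- the arc is one that the adjacency D ∼ D′ or E ∼ E′ already puts in A.
module Submission where

open import Defs
open import Data.Nat using (ℕ)
open import Data.Fin using (Fin)
open import Data.Fin.Subset using (Subset; _∪_; _∩_; _∈_; _∉_)
open import Data.Fin.Subset.Properties using (x∈p∪q⁻; x∈p∪q⁺; x∈p∩q⁻; x∈p∩q⁺; _∈?_)
open import Data.Product using (_×_; _,_)
open import Data.Sum using (_⊎_; inj₁; inj₂; [_,_])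
open import Function using (_∘_)
open import Relation.Nullary using (yes; no)

module _ {n : ℕ} {x : Fin n} {p q : Subset n} where

  x∉p∪q⁻ : x ∉ p ∪ q → x ∉ p × x ∉ q
  x∉p∪q⁻ x∉p∪q = x∉p∪q ∘ x∈p∪q⁺ ∘ inj₁ , x∉p∪q ∘ x∈p∪q⁺ {p = p} ∘ inj₂

  x∉p∩q⁻ : x ∉ p ∩ q → x ∉ p ⊎ x ∉ q
  x∉p∩q⁻ x∉p∩q with x ∈? p | x ∈? q
  ... | yes x∈p | yes x∈q = inj₁ λ _ → x∉p∩q (x∈p∩q⁺ (x∈p , x∈q))
  ... | no x∉p  | _       = inj₁ x∉p
  ... | yes _   | no x∉q  = inj₂ x∉q

module _ {ℓ ℓ′} (P : FinPoset ℓ) (A : SubDigraph P ℓ′) where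
  open FinPoset P
  open SubDigraph A using (Arc)

  Inside : Subset size → Subset size → Fin size → Fin size → Set
  Inside D D′ x y = InDiff D D′ x × InDiff D D′ y

  Covers : Subset size → Subset size → Set _
  Covers D D′ = ∀ x y → x ≤ y → Inside D D′ x y → Arc x y

  Adj⇒Covers : ∀ {D D′} → Adj P A D D′ → Covers D D′ × Covers D′ D
  Adj⇒Covers adj = (λ x y x≤y → adj x y x≤y ∘ inj₁) , (λ x y x≤y → adj x y x≤y ∘ inj₂)

  Covers⇒Adj : ∀ {D D′} → Covers D D′ → Covers D′ D → Adj P A D D′
  Covers⇒Adj c c′ x y x≤y = [ c x y x≤y , c′ x y x≤y ]

  Covers-split : ∀ {S S′ D D′ E E′} →
    (∀ {x y} → x ≤ y → Inside S S′ x y → Inside D D′ x y ⊎ Inside E E′ x y) →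
    Covers D D′ → Covers E E′ → Covers S S′
  Covers-split split cD cE x y x≤y = [ cD x y x≤y , cE x y x≤y ] ∘ split x≤y

  ∪-Inside-split : ∀ {D D′ E E′ x y} → IsDownset P D → IsDownset P E → x ≤ y →
    Inside (D ∪ E) (D′ ∪ E′) x y → Inside D D′ x y ⊎ Inside E E′ x y
  ∪-Inside-split {D} {D′} {E} downD downE x≤y ((_ , x∉) , (y∈ , y∉))
    with x∉p∪q⁻ {p = D′} x∉ | x∉p∪q⁻ {p = D′} y∉ | x∈p∪q⁻ D E y∈
  ... | x∉D′ , _ | y∉D′ , _ | inj₁ y∈D = inj₁ ((downD x≤y y∈D , x∉D′) , (y∈D , y∉D′))
  ... | _ , x∉E′ | _ , y∉E′ | inj₂ y∈E = inj₂ ((downE x≤y y∈E , x∉E′) , (y∈E , y∉E′))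

  ∩-Inside-split : ∀ {D D′ E E′ x y} → IsDownset P D′ → IsDownset P E′ → x ≤ y →
    Inside (D ∩ E) (D′ ∩ E′) x y → Inside D D′ x y ⊎ Inside E E′ x y
  ∩-Inside-split {D} {D′} {E} downD′ downE′ x≤y ((x∈ , x∉) , (y∈ , _))
    with x∈p∩q⁻ D E x∈ | x∈p∩q⁻ D E y∈ | x∉p∩q⁻ {p = D′} x∉
  ... | x∈D , _ | y∈D , _ | inj₁ x∉D′ = inj₁ ((x∈D , x∉D′) , (y∈D , x∉D′ ∘ downD′ x≤y))
  ... | _ , x∈E | _ , y∈E | inj₂ x∉E′ = inj₂ ((x∈E , x∉E′) , (y∈E , x∉E′ ∘ downE′ x≤y))

lemma4p4 : ∀ {ℓ ℓ′} (P : FinPoset ℓ) (A : SubDigraph P ℓ′)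
    (D D′ E E′ : Subset (FinPoset.size P)) →
    IsDownset P D → IsDownset P D′ → IsDownset P E → IsDownset P E′ →
    Adj P A D D′ → Adj P A E E′ →
    Adj P A (D ∪ E) (D′ ∪ E′) × Adj P A (D ∩ E) (D′ ∩ E′)
lemma4p4 P A D D′ E E′ downD downD′ downE downE′ adjD adjE =
  let cD , cD′ = Adj⇒Covers P A adjD
      cE , cE′ = Adj⇒Covers P A adjE
  in Covers⇒Adj P A
       (Covers-split P A (∪-Inside-split P A downD downE) cD cE)
       (Covers-split P A (∪-Inside-split P A downD′ downE′) cD′ cE′)
   , Covers⇒Adj P A
       (Covers-split P A (∩-Inside-split P A downD′ downE′) cD cE)
       (Covers-split P A (∩-Inside-split P A downD downE) cD′ cE′)
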